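{- Let $\mathrm{superLL}(\mathcal{E}, \leq_{\mathrm g}, \leq_{\mathrm f}, \leq_{\mathrm u})$ be a super-exponential linear logic system as described in the context, and let $\sigma \in \mathcal{E}$ satisfy the expansion axiom $$\sigma\leq_{\mathrm u}\sigma \quad\lor\quad \sigma\leq_{\mathrm f}\sigma \quad\lor\quad \big(\sigma\leq_{\mathrm g}\sigma \ \land\ \sigma(\mathrm{mpx}_1)\big).$$ Then for every formula $A$, one-step axiom expansion holds for $?_\sigma A$ and $!_\sigma A^\perp$: there is a derivation in the system, without cut, of the sequent $\vdash\, !_\sigma A^\perp, ?_\sigma A$ from the single open premise $\vdash A^\perp, A$. Moreover, if every $\sigma\in\mathcal{E}$ satisfies the expansion axiom, then axiom expansion holds in $\mathrm{superLL}(\mathcal{E}, \leq_{\mathrm g}, \leq_{\mathrm f}, \leq_{\mathrm u})$: for every formula $A$, the sequent $\vdash A^\perp, A$ has a cut-free proof in which the axiom rule is only applied to atomic formulas.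
   Context: The system $\mathrm{superLL}(\mathcal{E}, \leq_{\mathrm g}, \leq_{\mathrm f}, \leq_{\mathrm u})$ is parametrized by a set $\mathcal{E}$ of exponential signatures and three binary relations $\leq_{\mathrm g},\leq_{\mathrm f},\leq_{\mathrm u}$ on $\mathcal{E}$. Each signature $\sigma\in\mathcal{E}$ is a map assigning a boolean to each rule name $\mathrm{mpx}_i$ and $\mathrm{contr}_i$ ($i\in\mathbb{N}$). Formulas are those of linear logic (atoms $X, X^\perp$, units $1,\bot,\top,0$, connectives $\otimes,⅋,\oplus,\&$) together with modalities $!_\sigma A$ and $?_\sigma A$ for each $\sigma\in\mathcal{E}$; negation $(\cdot)^\perp$ is defined by De Morgan duality, with $(!_\sigma A)^\perp = ?_\sigma A^\perp$. Sequents are one-sided, $\vdash\Gamma$. The rules are the axiom $\vdash A^\perp, A$, cut, the usual multiplicative–additive rules, and the exponential rules: (mpx$_i$) from $\vdash A,\dots,A,\Gamma$ ($i$ copies of $A$) infer $\vdash ?_\sigma A,\Gamma$, provided $\sigma(\mathrm{mpx}_i)$ is true; (contr$_i$) from $\vdash ?_\sigma A,\dots,?_\sigma A,\Gamma$ ($i$ copies) infer $\vdash ?_\sigma A,\Gamma$, provided $\sigma(\mathrm{contr}_i)$ is true; ($!_{\mathrm g}$) from $\vdash A, ?_{\tau_1}B_1,\dots,?_{\tau_n}B_n$ infer $\vdash !_\sigma A, ?_{\tau_1}B_1,\dots,?_{\tau_n}B_n$, provided $\sigma\leq_{\mathrm g}\tau_k$ for all $k$; ($!_{\mathrm f}$)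 from $\vdash A, B_1,\dots,B_n$ infer $\vdash !_\sigma A, ?_{\tau_1}B_1,\dots,?_{\tau_n}B_n$, provided $\sigma\leq_{\mathrm f}\tau_k$ for all $k$; ($!_{\mathrm u}$) from $\vdash A, B$ infer $\vdash !_\sigma A, ?_\tau B$, provided $\sigma\leq_{\mathrm u}\tau$. In particular $\mathrm{mpx}_1$ is a dereliction rule (from $\vdash A,\Gamma$ infer $\vdash ?_\sigma A,\Gamma$). -}

module Defs where

open import Data.Nat using (ℕ)
open import Data.Bool using (Bool; T)
open import Data.Empty using (⊥)
open import Data.Product using (_×_; _,_; proj₁; proj₂)
open import Data.Sum using (_⊎_)
open import Data.List using (List; []; _∷_; _++_; replicate; map)
open import Data.List.Relation.Unary.All using (All)
open import Data.List.Relation.Binary.Permutation.Propositional using (_↭_)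
open import Relation.Binary.PropositionalEquality using (_≡_)

data RuleName : Set where
  mpx   : ℕ → RuleName
  contr : ℕ → RuleName

-- A superLL system: a set E of (names of) exponential signatures, the map
-- assigning to each one its boolean signature, and the three relations.
record System : Set₁ where
  field
    E     : Set
    sig   : E → RuleName → Bool
    _≤g_  : E → E → Set
    _≤f_  : E → E → Set
    _≤u_  : E → E → Set
open System public

data Fml (E : Set) : Set where
  var covar : ℕ → Fml E
  𝟙 ⊥' ⊤' 𝟘 : Fml E
  _⊗_ _⅋_ _⊕_ _&_ : Fml E → Fml E → Fml E
  !_[_] ⁇_[_] : E → Fml E → Fml E

infixr 20 _⊗_ _⅋_ _⊕_ _&_

_ᗮ : {E : Set} → Fml E → Fml E
var n ᗮ = covar n
covar n ᗮ = var n
𝟙 ᗮ = ⊥'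
⊥' ᗮ = 𝟙
⊤' ᗮ = 𝟘
𝟘 ᗮ = ⊤'
(A ⊗ B) ᗮ = (A ᗮ) ⅋ (B ᗮ)
(A ⅋ B) ᗮ = (A ᗮ) ⊗ (B ᗮ)
(A ⊕ B) ᗮ = (A ᗮ) & (B ᗮ)
(A & B) ᗮ = (A ᗮ) ⊕ (B ᗮ)
(! σ [ A ]) ᗮ = ⁇ σ [ A ᗮ ]
(⁇ σ [ A ]) ᗮ = ! σ [ A ᗮ ]

data IsAtom {E : Set} : Fml E → Set where
  atom-var   : ∀ n → IsAtom (var n)
  atom-covar : ∀ n → IsAtom (covar n)

-- ?-contexts  ?_{τ1} B1, ..., ?_{τn} Bn  given as lists of pairs (τk , Bk).
whyNots : {E : Set} → List (E × Fml E) → List (Fml E)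
whyNots = map (λ p → ⁇ proj₁ p [ proj₂ p ])

bodies : {E : Set} → List (E × Fml E) → List (Fml E)
bodies = map proj₂

-- Derivations of one-sided sequents (lists up to the exchange rule) in
-- superLL(E, ≤g, ≤f, ≤u), with
--   Prem  : the open premises (hypotheses) allowed,
--   AxOK  : the formulas A on which the axiom ⊢ A⊥, A may be applied,
--   CutOK : inhabited iff the cut rule may be used.
data Deriv (S : System) (Prem : List (Fml (E S)) → Set)
           (AxOK : Fml (E S) → Set) (CutOK : Set) : List (Fml (E S)) → Set where
  prem  : ∀ {Γ} → Prem Γ → Deriv S Prem AxOK CutOK Γ
  ax    : ∀ {A} → AxOK A → Deriv S Prem AxOK CutOK (A ᗮ ∷ A ∷ [])
  cut   : ∀ {A Γ Δ} → CutOK → Deriv S Prem AxOK CutOK (A ∷ Γ)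
        → Deriv S Prem AxOK CutOK (A ᗮ ∷ Δ) → Deriv S Prem AxOK CutOK (Γ ++ Δ)
  ex    : ∀ {Γ Δ} → Γ ↭ Δ → Deriv S Prem AxOK CutOK Γ → Deriv S Prem AxOK CutOK Δ
  one   : Deriv S Prem AxOK CutOK (𝟙 ∷ [])
  bot   : ∀ {Γ} → Deriv S Prem AxOK CutOK Γ → Deriv S Prem AxOK CutOK (⊥' ∷ Γ)
  top   : ∀ {Γ} → Deriv S Prem AxOK CutOK (⊤' ∷ Γ)
  tens  : ∀ {A B Γ Δ} → Deriv S Prem AxOK CutOK (A ∷ Γ) → Deriv S Prem AxOK CutOK (B ∷ Δ)
        → Deriv S Prem AxOK CutOK (A ⊗ B ∷ Γ ++ Δ)
  parr  : ∀ {A B Γ} → Deriv S Prem AxOK CutOK (A ∷ B ∷ Γ) → Deriv S Prem AxOK CutOK (A ⅋ B ∷ Γ)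
  plus₁ : ∀ {A B Γ} → Deriv S Prem AxOK CutOK (A ∷ Γ) → Deriv S Prem AxOK CutOK (A ⊕ B ∷ Γ)
  plus₂ : ∀ {A B Γ} → Deriv S Prem AxOK CutOK (B ∷ Γ) → Deriv S Prem AxOK CutOK (A ⊕ B ∷ Γ)
  with' : ∀ {A B Γ} → Deriv S Prem AxOK CutOK (A ∷ Γ) → Deriv S Prem AxOK CutOK (B ∷ Γ)
        → Deriv S Prem AxOK CutOK (A & B ∷ Γ)
  mpxR  : ∀ {σ A Γ} (i : ℕ) → T (sig S σ (mpx i))
        → Deriv S Prem AxOK CutOK (replicate i A ++ Γ)
        → Deriv S Prem AxOK CutOK (⁇ σ [ A ] ∷ Γ)
  contrR : ∀ {σ A Γ} (i : ℕ) → T (sig S σ (contr i))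
        → Deriv S Prem AxOK CutOK (replicate i (⁇ σ [ A ]) ++ Γ)
        → Deriv S Prem AxOK CutOK (⁇ σ [ A ] ∷ Γ)
  bangG : ∀ {σ A} (Δ : List (E S × Fml (E S))) → All (λ p → _≤g_ S σ (proj₁ p)) Δ
        → Deriv S Prem AxOK CutOK (A ∷ whyNots Δ)
        → Deriv S Prem AxOK CutOK (! σ [ A ] ∷ whyNots Δ)
  bangF : ∀ {σ A} (Δ : List (E S × Fml (E S))) → All (λ p → _≤f_ S σ (proj₁ p)) Δ
        → Deriv S Prem AxOK CutOK (A ∷ bodies Δ)
        → Deriv S Prem AxOK CutOK (! σ [ A ] ∷ whyNots Δ)
  bangU : ∀ {σ τ A B} → _≤u_ S σ τ
        → Deriv S Prem AxOK CutOK (A ∷ B ∷ [])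
        → Deriv S Prem AxOK CutOK (! σ [ A ] ∷ ⁇ τ [ B ] ∷ [])

ExpansionAxiom : (S : System) → E S → Set
ExpansionAxiom S σ =
  _≤u_ S σ σ ⊎ (_≤f_ S σ σ ⊎ (_≤g_ S σ σ × T (sig S σ (mpx 1))))

FromPremise : (S : System) → List (Fml (E S)) → List (Fml (E S)) → Set
FromPremise S Γ₀ Γ = Deriv S (λ Δ → Δ ≡ Γ₀) (λ _ → ⊥) ⊥ Γ

AtomicCutFreeProof : (S : System) → List (Fml (E S)) → Set
AtomicCutFreeProof S Γ = Deriv S (λ _ → ⊥) IsAtom ⊥ Γ

-- Each clause of the expansion axiom licenses one promotion rule that turns
-- ⊢ B, A into ⊢ !σ B, ?σ A: (!u) directly, (!f) with the one-formula context
-- ?σ A, and (!g) after first derelicting A into ?σ A with mpx₁. Full axiom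
-- expansion then follows by induction on the formula, introducing the main
-- connective and its dual on the two sides of ⊢ A⊥, A.
module Submission where

open import Defs
open import Data.Product using (_×_; _,_)
open import Data.Sum using (inj₁; inj₂)
open import Data.List using (List; _∷_; [])
open import Data.List.Relation.Unary.All using (_∷_; [])
open import Data.List.Relation.Binary.Permutation.Propositional using (refl; prep; swap; trans)
open import Relation.Binary.PropositionalEquality using (refl)

module _ {S : System} {Prem : List (Fml (E S)) → Set} {AxOK : Fml (E S) → Set} {CutOK : Set} where
  private
    Derivation : List (Fml (E S)) → Set
    Derivation = Deriv S Prem AxOK CutOK

  exchange : ∀ {A B} → Derivation (A ∷ B ∷ []) → Derivation (B ∷ A ∷ [])
  exchange {A} {B} = ex (swap A B refl)

  rotate : ∀ {A B C} → Derivation (A ∷ B ∷ C ∷ []) → Derivation (B ∷ C ∷ A ∷ [])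
  rotate {A} {B} {C} = ex (trans (swap A B refl) (prep B (swap A C refl)))

  promote : ∀ {σ A B} → ExpansionAxiom S σ →
    Derivation (B ∷ A ∷ []) → Derivation (! σ [ B ] ∷ ⁇ σ [ A ] ∷ [])
  promote (inj₁ σ≤uσ) d = bangU σ≤uσ d
  promote {σ} {A} (inj₂ (inj₁ σ≤fσ)) d = bangF ((σ , A) ∷ []) (σ≤fσ ∷ []) d
  promote {σ} {A} (inj₂ (inj₂ (σ≤gσ , mpx₁))) d =
    bangG ((σ , A) ∷ []) (σ≤gσ ∷ []) (exchange (mpxR 1 mpx₁ (exchange d)))

atomicAxiomExpansion : (S : System) → ((σ : E S) → ExpansionAxiom S σ) →
  (A : Fml (E S)) → AtomicCutFreeProof S (A ᗮ ∷ A ∷ [])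
atomicAxiomExpansion S exp (var n) = ax (atom-var n)
atomicAxiomExpansion S exp (covar n) = ax (atom-covar n)
atomicAxiomExpansion S exp 𝟙 = bot one
atomicAxiomExpansion S exp ⊥' = exchange (bot one)
atomicAxiomExpansion S exp ⊤' = exchange top
atomicAxiomExpansion S exp 𝟘 = top
atomicAxiomExpansion S exp (A ⊗ B) =
  parr (rotate (tens (exchange (atomicAxiomExpansion S exp A))
                     (exchange (atomicAxiomExpansion S exp B))))
atomicAxiomExpansion S exp (A ⅋ B) =
  exchange (parr (rotate (tens (atomicAxiomExpansion S exp A)
                               (atomicAxiomExpansion S exp B))))
atomicAxiomExpansion S exp (A ⊕ B) =
  with' (exchange (plus₁ (exchange (atomicAxiomExpansion S exp A))))
        (exchange (plus₂ (exchange (atomicAxiomExpansion S exp B))))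
atomicAxiomExpansion S exp (A & B) =
  exchange (with' (exchange (plus₁ (atomicAxiomExpansion S exp A)))
                  (exchange (plus₂ (atomicAxiomExpansion S exp B))))
atomicAxiomExpansion S exp (! σ [ A ]) =
  exchange (promote (exp σ) (exchange (atomicAxiomExpansion S exp A)))
atomicAxiomExpansion S exp (⁇ σ [ A ]) = promote (exp σ) (atomicAxiomExpansion S exp A)

mainTheorem1 : (S : System) →
    ((σ : E S) → ExpansionAxiom S σ → (A : Fml (E S)) →
      FromPremise S (A ᗮ ∷ A ∷ []) (! σ [ A ᗮ ] ∷ ⁇ σ [ A ] ∷ []))
    × (((σ : E S) → ExpansionAxiom S σ) → (A : Fml (E S)) →
      AtomicCutFreeProof S (A ᗮ ∷ A ∷ []))
mainTheorem1 S = (λ σ exp A → promote exp (prem refl)) , atomicAxiomExpansion S
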